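{- Let $S$ be as in the context and suppose that $|\Pi_1|$ is odd. Then the nontrivial orbits of $F_2^n$ under the group $\mathbf W_P$ (acting by left multiplication) are the sets $U_{\{i\}}=\{u\in F_2^n: sw(u)=i\}$ for $1\le i\le n$.
   Context: $S$ is a finite simple connected graph with vertex set $\{s_1,\dots,s_n\}$, $n\ge2$, and edge set $R$, such that $s_1,\dots,s_{n-1}$ is an induced path; $s_n$ is adjacent to some of $s_1,\dots,s_{n-1}$. $\widetilde s$ is the characteristic vector in $F_2^n$ (coordinates indexed by vertices) of vertex $s$. The flipping move of $s$ is $\mathbf s\in\mathrm{Mat}_n(F_2)$ with $\mathbf s_{ab}=1$ if $a=b$, or if $b=s$ and $ab\in R$, and $0$ otherwise. $\mathbf W_P$ is the subgroup of $\mathrm{GL}_n(F_2)$ generated by $\mathbf{s_1},\dots,\mathbf{s_{n-1}}$. $\overline1=\widetilde s_1$ and $\overline{i+1}=\mathbf{s_i}\cdots\mathbf{s_1}\overline1$ for $1\le i\le n-1$. $\Pi=\{\overline1,\dots,\overline n\}$, $\Pi_0=\{\overline i\in\Pi:\langle\overline i,\widetilde s_n\rangle=0\}$, and $\Pi_1=\Pi\setminus\Pi_0$. When $|\Pi_1|$ is odd, $\Delta=\Pi$ is a basis of $F_2^n$ (and $U:=\mathrm{span}(\Pi)=F_2^n$). $sw(u)$ is the number of elements of $\Delta$ appearing in the expansion of $u$ in the basis $\Delta$. -}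

module Defs where

open import Data.Nat using (ℕ; zero; suc; _≡ᵇ_)
open import Data.Bool using (Bool; true; false; _∧_; _∨_; _xor_; if_then_else_)
open import Data.Fin using (Fin; zero; suc; toℕ; _≟_)
open import Data.Maybe using (Maybe; just; nothing)
import Data.Maybe as Maybe
open import Data.List using (List; []; _∷_)
open import Data.Product using (Σ; _×_; ∃)
open import Relation.Nullary.Decidable using (⌊_⌋)
open import Relation.Binary.PropositionalEquality using (_≡_)

-- Vectors of F₂ⁿ (coordinates indexed by Fin n), F₂ = Bool with xor / ∧.
Vecℱ : ℕ → Set
Vecℱ n = Fin n → Bool

Mat : ℕ → Set
Mat n = Fin n → Fin n → Bool

⊕Σ : ∀ {m} → (Fin m → Bool) → Bool
⊕Σ {zero}  f = false
⊕Σ {suc m} f = f zero xor ⊕Σ (λ i → f (suc i))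

countTrue : ∀ {m} → (Fin m → Bool) → ℕ
countTrue {zero}  f = 0
countTrue {suc m} f = (if f zero then 1 else 0) Data.Nat.+ countTrue (λ i → f (suc i))

_≈_ : ∀ {n} → Vecℱ n → Vecℱ n → Set
u ≈ v = ∀ a → u a ≡ v a

zeroV : ∀ {n} → Vecℱ n
zeroV a = false

⟨_,_⟩ : ∀ {n} → Vecℱ n → Vecℱ n → Bool
⟨ x , y ⟩ = ⊕Σ (λ a → x a ∧ y a)

_·_ : ∀ {n} → Mat n → Vecℱ n → Vecℱ n
(M · x) a = ⊕Σ (λ b → M a b ∧ x b)

_⊗_ : ∀ {n} → Mat n → Mat n → Mat n
(M ⊗ N) a c = ⊕Σ (λ b → M a b ∧ N b c)

idM : ∀ {n} → Mat n
idM a b = ⌊ a ≟ b ⌋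

-- Splitting a vertex of Fin (suc k): `just i` for the path vertex s_{i+1}
-- (i : Fin k), `nothing` for the extra vertex s_n (the last index).
pathPart : ∀ {k} → Fin (suc k) → Maybe (Fin k)
pathPart {zero}  zero    = nothing
pathPart {suc k} zero    = just zero
pathPart {suc k} (suc i) = Maybe.map suc (pathPart i)

-- The graph S on n = suc k vertices s_1,…,s_n (s_j ↦ index j-1).
-- s_1,…,s_k is an induced path; s_n is adjacent exactly to the path
-- vertices s_{j+1} with T j ≡ true.
module Graph (k : ℕ) (T : Fin k → Bool) where

  n : ℕ
  n = suc k

  adj : Fin n → Fin n → Bool
  adj a b with pathPart a | pathPart b
  ... | just i  | just j  = (toℕ i ≡ᵇ suc (toℕ j)) ∨ (toℕ j ≡ᵇ suc (toℕ i))
  ... | nothing | just j  = T j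
  ... | just i  | nothing = T i
  ... | nothing | nothing = false

  char : Fin n → Vecℱ n
  char s a = ⌊ a ≟ s ⌋

  flipM : Fin n → Mat n
  flipM s a b = ⌊ a ≟ b ⌋ ∨ (⌊ b ≟ s ⌋ ∧ adj a b)

  pathVertex : Fin k → Fin n
  pathVertex = Data.Fin.inject₁

  gen : Fin k → Mat n
  gen i = flipM (pathVertex i)

  wordM : List (Fin k) → Mat n
  wordM []      = idM
  wordM (i ∷ w) = gen i ⊗ wordM w

  -- membership in W_P = ⟨𝐬_1,…,𝐬_{n-1}⟩ ≤ GL_n(F₂)
  -- (each generator is an involution, so the generated subgroup is the set
  --  of finite products of generators)
  InWP : Mat n → Set
  InWP M = Σ (List (Fin k)) λ w → ∀ a b → M a b ≡ wordM w a b

  InOrbit : Vecℱ n → Vecℱ n → Set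
  InOrbit u v = Σ (Mat n) λ M → InWP M × ((M · u) ≈ v)

  -- Π: bar m is  \overline{m+1};  bar 0 = s̃_1, bar (m+1) = 𝐬_{m+1} (bar m)
  -- (for m < k), i.e. \overline{i+1} = 𝐬_i ⋯ 𝐬_1 \overline 1.
  flipℕ : ℕ → Mat n
  flipℕ m a b = ⌊ a ≟ b ⌋ ∨ ((toℕ b ≡ᵇ m) ∧ adj a b)

  bar : ℕ → Vecℱ n
  bar zero    = char zero
  bar (suc m) = flipℕ m · bar m

  Πv : Fin n → Vecℱ n
  Πv i = bar (toℕ i)

  lastV : Fin n
  lastV = Data.Fin.fromℕ k

  cardΠ₁ : ℕ
  cardΠ₁ = countTrue (λ i → ⟨ Πv i , char lastV ⟩)

  comb : (Fin n → Bool) → Vecℱ n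
  comb c a = ⊕Σ (λ i → c i ∧ Πv i a)

  -- u ∈ U_{i} : the expansion of u in the basis Δ = Π has exactly i terms,
  -- i.e. sw(u) = i
  InU : ℕ → Vecℱ n → Set
  InU i u = Σ (Fin n → Bool) λ c → (comb c ≈ u) × (countTrue c ≡ i)

-- W_P permutes Π: the generator 𝐬_m fixes every \overline i except \overline m and
-- \overline{m+1}, which it swaps. So on expansions Σ cᵢ \overline i, W_P acts by permuting
-- the coefficient vector c through adjacent transpositions, and these act transitively on
-- the coefficient vectors of each weight: the orbit of Σ cᵢ \overline i consists of the
-- vectors having an expansion of weight |c|.
-- When |Π₁| is odd, Π is a basis. On the path vertices \overline{j+1} = s̃_j + s̃_{j+1}
-- (with s̃_0 = 0), so the path coordinates of Σ cᵢ \overline i are the sums c_j + c_{j+1};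
-- they determine c up to complement, and complementing c toggles the last coordinate,
-- since the last coordinate of Σ \overline i is |Π₁| mod 2 = 1.

module Submission where

open import Defs
open import Algebra.Bundles using (CommutativeMonoid; CommutativeRing)
open import Data.Bool using (Bool; true; false; if_then_else_; _∧_; _∨_; _xor_; not)
open import Data.Bool.Properties
  using (∧-comm; ∧-assoc; ∧-zeroʳ; xor-assoc; xor-same; xor-identityʳ;
         not-distribˡ-xor; ∧-distribˡ-xor; ∧-distribʳ-xor; not-involutive;
         xor-∧-commutativeRing; ∧-commutativeMonoid; T-≡; ¬-not)
open import Data.Fin using (Fin; zero; suc; toℕ; _≟_; inject₁; fromℕ; fromℕ<)
open import Data.Fin.Properties
  using (suc-injective; toℕ-injective; toℕ-inject₁; toℕ-fromℕ<; toℕ≤pred[n])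
open import Data.List using (List; []; _∷_; _++_; [_]; map; reverse)
open import Data.List.Properties using (unfold-reverse)
open import Data.Maybe using (just; nothing)
open import Data.Nat using (ℕ; zero; suc; _≡ᵇ_; _<ᵇ_; _+_; _≤_; z≤n; s≤s; _%_)
open import Data.Nat.Properties
  using (≡ᵇ⇒≡; ≡⇒≡ᵇ; +-commutativeSemigroup; m≤n⇒m≤1+n; n≤1+n; ≤-trans)
open import Data.Product using (Σ; _×_; _,_; ∃)
open import Data.Sum using (_⊎_; inj₁; inj₂)
open import Data.Vec.Functional using () renaming (_∷_ to _∷ᶠ_)
open import Function using (_∘_)
open import Function.Bundles using (_⇔_; mk⇔; Equivalence)
open import Relation.Nullary using (¬_; yes; no; contradiction)
open import Relation.Nullary.Decidable using (⌊_⌋; toWitness; fromWitness)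
open import Relation.Binary.PropositionalEquality
  using (_≡_; _≢_; refl; sym; trans; cong; cong₂; _≗_; _→-setoid_; module ≡-Reasoning)
import Relation.Binary.Reasoning.Setoid as SetoidReasoning
import Algebra.Properties.CommutativeSemigroup as CommSemigroupProperties

private
  module XorProperties =
    CommSemigroupProperties (CommutativeRing.+-commutativeSemigroup xor-∧-commutativeRing)
  module ∧Properties =
    CommSemigroupProperties (CommutativeMonoid.commutativeSemigroup ∧-commutativeMonoid)
  module +Properties = CommSemigroupProperties +-commutativeSemigroup

xor≡false⇒≡ : ∀ {a b} → a xor b ≡ false → a ≡ b
xor≡false⇒≡ {false} {false} _ = refl
xor≡false⇒≡ {true}  {true}  _ = refl

-- F₂-sums

⊕Σ-cong : ∀ {m} {f g : Fin m → Bool} → f ≗ g → ⊕Σ f ≡ ⊕Σ g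
⊕Σ-cong {zero}  f≗g = refl
⊕Σ-cong {suc m} f≗g = cong₂ _xor_ (f≗g zero) (⊕Σ-cong (f≗g ∘ suc))

⊕Σ-distrib-xor : ∀ {m} (f g : Fin m → Bool) →
                 ⊕Σ (λ i → f i xor g i) ≡ ⊕Σ f xor ⊕Σ g
⊕Σ-distrib-xor {zero}  f g = refl
⊕Σ-distrib-xor {suc m} f g =
  trans (cong ((f zero xor g zero) xor_) (⊕Σ-distrib-xor (f ∘ suc) (g ∘ suc)))
        (XorProperties.interchange (f zero) (g zero) (⊕Σ (f ∘ suc)) (⊕Σ (g ∘ suc)))

∧-distribˡ-⊕Σ : ∀ {m} x (f : Fin m → Bool) → x ∧ ⊕Σ f ≡ ⊕Σ (λ i → x ∧ f i)
∧-distribˡ-⊕Σ {zero}  x f = ∧-zeroʳ x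
∧-distribˡ-⊕Σ {suc m} x f =
  trans (∧-distribˡ-xor x (f zero) (⊕Σ (f ∘ suc)))
        (cong ((x ∧ f zero) xor_) (∧-distribˡ-⊕Σ x (f ∘ suc)))

∧-distribʳ-⊕Σ : ∀ {m} x (f : Fin m → Bool) → ⊕Σ f ∧ x ≡ ⊕Σ (λ i → f i ∧ x)
∧-distribʳ-⊕Σ {zero}  x f = refl
∧-distribʳ-⊕Σ {suc m} x f =
  trans (∧-distribʳ-xor x (f zero) (⊕Σ (f ∘ suc)))
        (cong ((f zero ∧ x) xor_) (∧-distribʳ-⊕Σ x (f ∘ suc)))

⊕Σ-zero : ∀ {m} (f : Fin m → Bool) → (∀ i → f i ≡ false) → ⊕Σ f ≡ false
⊕Σ-zero {zero}  f f≡0 = refl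
⊕Σ-zero {suc m} f f≡0 rewrite f≡0 zero = ⊕Σ-zero (f ∘ suc) (f≡0 ∘ suc)

⊕Σ-comm : ∀ {m p} (f : Fin m → Fin p → Bool) →
          ⊕Σ (λ i → ⊕Σ (f i)) ≡ ⊕Σ (λ j → ⊕Σ (λ i → f i j))
⊕Σ-comm {zero} {p} f = sym (⊕Σ-zero {p} _ (λ _ → refl))
⊕Σ-comm {suc m} f =
  trans (cong (⊕Σ (f zero) xor_) (⊕Σ-comm (f ∘ suc)))
        (sym (⊕Σ-distrib-xor (f zero) (λ j → ⊕Σ (λ i → f (suc i) j))))

Selects : ∀ {m} → (Fin m → Bool) → Fin m → Set
Selects D s = ∀ b → D b ≡ true ⇔ b ≡ s

⊕Σ-select : ∀ {m} {D : Fin m → Bool} {s} → Selects D s →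
            (f : Fin m → Bool) → ⊕Σ (λ b → D b ∧ f b) ≡ f s
⊕Σ-select {suc m} {D} {zero} D-sel f
  rewrite Equivalence.from (D-sel zero) refl =
  trans (cong (f zero xor_) (⊕Σ-zero _ elsewhere)) (xor-identityʳ (f zero))
  where
  elsewhere : ∀ i → D (suc i) ∧ f (suc i) ≡ false
  elsewhere i with D (suc i) in e
  ... | false = refl
  ... | true  = contradiction (Equivalence.to (D-sel (suc i)) e) λ ()
⊕Σ-select {suc m} {D} {suc s} D-sel f with D zero in e
... | true  = contradiction (Equivalence.to (D-sel zero) e) λ ()
... | false = ⊕Σ-select tail-sel (f ∘ suc)
  where
  tail-sel : Selects (D ∘ suc) s
  tail-sel b = mk⇔ (suc-injective ∘ Equivalence.to (D-sel (suc b)))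
                   (Equivalence.from (D-sel (suc b)) ∘ cong suc)

≟-selects : ∀ {m} (s : Fin m) → Selects (λ b → ⌊ b ≟ s ⌋) s
≟-selects s b = mk⇔ (toWitness ∘ Equivalence.from T-≡)
                    (Equivalence.to T-≡ ∘ fromWitness)

≟-selectsˡ : ∀ {m} (a : Fin m) → Selects (λ b → ⌊ a ≟ b ⌋) a
≟-selectsˡ a b = mk⇔ (sym ∘ toWitness ∘ Equivalence.from T-≡)
                     (Equivalence.to T-≡ ∘ fromWitness ∘ sym)

≡ᵇ-selects : ∀ {m} (s : Fin m) {t} → toℕ s ≡ t → Selects (λ b → toℕ b ≡ᵇ t) s
≡ᵇ-selects s {t} s≡t b =
  mk⇔ (λ e → toℕ-injective (trans (≡ᵇ⇒≡ (toℕ b) t (Equivalence.from T-≡ e)) (sym s≡t)))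
      (λ { refl → Equivalence.to T-≡ (≡⇒≡ᵇ (toℕ s) t s≡t) })

boolToℕ : Bool → ℕ
boolToℕ b = if b then 1 else 0

countTrue≤ : ∀ {m} (f : Fin m → Bool) → countTrue f ≤ m
countTrue≤ {zero}  f = z≤n
countTrue≤ {suc m} f with f zero
... | true  = s≤s (countTrue≤ (f ∘ suc))
... | false = m≤n⇒m≤1+n (countTrue≤ (f ∘ suc))

countTrue≡0 : ∀ {m} (f : Fin m → Bool) → countTrue f ≡ 0 → ∀ i → f i ≡ false
countTrue≡0 {suc m} f c≡0 i with f zero in e
countTrue≡0 {suc m} f () i       | true
countTrue≡0 {suc m} f c≡0 zero    | false = e
countTrue≡0 {suc m} f c≡0 (suc i) | false = countTrue≡0 (f ∘ suc) c≡0 i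

1≤countTrue : ∀ {m} (f : Fin m → Bool) → ¬ (∀ i → f i ≡ false) → 1 ≤ countTrue f
1≤countTrue f f≢0 with countTrue f in c≡
... | zero  = contradiction (countTrue≡0 f c≡) f≢0
... | suc _ = s≤s z≤n

isOdd : ℕ → Bool
isOdd zero    = false
isOdd (suc n) = not (isOdd n)

isOdd-countTrue : ∀ {m} (f : Fin m → Bool) → isOdd (countTrue f) ≡ ⊕Σ f
isOdd-countTrue {zero}  f = refl
isOdd-countTrue {suc m} f with f zero
... | true  = cong not (isOdd-countTrue (f ∘ suc))
... | false = isOdd-countTrue (f ∘ suc)

%2≡1⇒isOdd : ∀ n → n % 2 ≡ 1 → isOdd n ≡ true
%2≡1⇒isOdd (suc zero)    _ = refl
%2≡1⇒isOdd (suc (suc n)) p = trans (not-involutive (isOdd n)) (%2≡1⇒isOdd n p)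

-- [j ∈ {i, i+1}], written with xor so that it splits into two indicators
near : ℕ → ℕ → Bool
near i j = (j ≡ᵇ i) xor (j ≡ᵇ suc i)

adjacentℕ : ℕ → ℕ → Bool
adjacentℕ i j = (i ≡ᵇ suc j) ∨ (j ≡ᵇ suc i)

near-diag : ∀ j → near j j ≡ true
near-diag zero    = refl
near-diag (suc j) = near-diag j

near-step : ∀ i j → near i j xor adjacentℕ i j ≡ near i (suc j)
near-step zero          zero          = refl
near-step zero          (suc zero)    = refl
near-step zero          (suc (suc j)) = refl
near-step (suc zero)    zero          = refl
near-step (suc (suc i)) zero          = refl
near-step (suc i)       (suc j)       = near-step i j

adjacentℕ-irrefl : ∀ i → adjacentℕ i i ≡ false
adjacentℕ-irrefl zero    = refl
adjacentℕ-irrefl (suc i) = adjacentℕ-irrefl i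

-- Adjacent transpositions

transposeAdj : ∀ {k} → Fin k → Fin (suc k) → Fin (suc k)
transposeAdj zero    zero          = suc zero
transposeAdj zero    (suc zero)    = zero
transposeAdj zero    (suc (suc i)) = suc (suc i)
transposeAdj (suc m) zero          = zero
transposeAdj (suc m) (suc i)       = suc (transposeAdj m i)

transposeAdj-involutive : ∀ {k} (m : Fin k) i → transposeAdj m (transposeAdj m i) ≡ i
transposeAdj-involutive zero    zero          = refl
transposeAdj-involutive zero    (suc zero)    = refl
transposeAdj-involutive zero    (suc (suc i)) = refl
transposeAdj-involutive (suc m) zero          = refl
transposeAdj-involutive (suc m) (suc i)       = cong suc (transposeAdj-involutive m i)

transposeAdj-inject₁ : ∀ {k} (m : Fin k) → transposeAdj m (inject₁ m) ≡ suc m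
transposeAdj-inject₁ zero    = refl
transposeAdj-inject₁ (suc m) = cong suc (transposeAdj-inject₁ m)

transposeAdj-suc : ∀ {k} (m : Fin k) → transposeAdj m (suc m) ≡ inject₁ m
transposeAdj-suc zero    = refl
transposeAdj-suc (suc m) = cong suc (transposeAdj-suc m)

transposeAdj-cases : ∀ {k} (m : Fin k) i →
  i ≡ inject₁ m ⊎ i ≡ suc m ⊎ (transposeAdj m i ≡ i × near (toℕ m) (toℕ i) ≡ false)
transposeAdj-cases zero    zero          = inj₁ refl
transposeAdj-cases zero    (suc zero)    = inj₂ (inj₁ refl)
transposeAdj-cases zero    (suc (suc i)) = inj₂ (inj₂ (refl , refl))
transposeAdj-cases (suc m) zero          = inj₂ (inj₂ (refl , refl))
transposeAdj-cases (suc m) (suc i) with transposeAdj-cases m i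
... | inj₁ i≡m               = inj₁ (cong suc i≡m)
... | inj₂ (inj₁ i≡m+1)      = inj₂ (inj₁ (cong suc i≡m+1))
... | inj₂ (inj₂ (fixed , far)) = inj₂ (inj₂ (cong suc fixed , far))

⊕Σ-transposeAdj : ∀ {k} (m : Fin k) (f : Fin (suc k) → Bool) →
                  ⊕Σ (f ∘ transposeAdj m) ≡ ⊕Σ f
⊕Σ-transposeAdj zero    f =
  XorProperties.x∙yz≈y∙xz (f (suc zero)) (f zero) (⊕Σ (λ i → f (suc (suc i))))
⊕Σ-transposeAdj (suc m) f = cong (f zero xor_) (⊕Σ-transposeAdj m (f ∘ suc))

countTrue-transposeAdj : ∀ {k} (m : Fin k) (f : Fin (suc k) → Bool) →
                         countTrue (f ∘ transposeAdj m) ≡ countTrue f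
countTrue-transposeAdj zero    f =
  +Properties.x∙yz≈y∙xz (boolToℕ (f (suc zero))) (boolToℕ (f zero))
                        (countTrue (λ i → f (suc (suc i))))
countTrue-transposeAdj (suc m) f = cong (boolToℕ (f zero) +_) (countTrue-transposeAdj m (f ∘ suc))

permute : ∀ {k} → List (Fin k) → Fin (suc k) → Fin (suc k)
permute []      i = i
permute (m ∷ w) i = permute w (transposeAdj m i)

permute-++ : ∀ {k} (w w′ : List (Fin k)) i → permute (w ++ w′) i ≡ permute w′ (permute w i)
permute-++ []      w′ i = refl
permute-++ (m ∷ w) w′ i = permute-++ w w′ (transposeAdj m i)

permute-reverse : ∀ {k} (w : List (Fin k)) i → permute w (permute (reverse w) i) ≡ i
permute-reverse []      i = refl
permute-reverse (m ∷ w) i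
  rewrite unfold-reverse m w
        | permute-++ (reverse w) [ m ] i
        | transposeAdj-involutive m (permute (reverse w) i) = permute-reverse w i

permute-map-suc-zero : ∀ {k} (w : List (Fin k)) → permute (map suc w) zero ≡ zero
permute-map-suc-zero []      = refl
permute-map-suc-zero (m ∷ w) = permute-map-suc-zero w

permute-map-suc : ∀ {k} (w : List (Fin k)) i → permute (map suc w) (suc i) ≡ suc (permute w i)
permute-map-suc []      i = refl
permute-map-suc (m ∷ w) i = permute-map-suc w (transposeAdj m i)

countTrue-permute : ∀ {k} (w : List (Fin k)) (f : Fin (suc k) → Bool) →
                    countTrue (f ∘ permute w) ≡ countTrue f
countTrue-permute []      f = refl
countTrue-permute (m ∷ w) f =
  trans (countTrue-transposeAdj m (f ∘ permute w)) (countTrue-permute w f)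

firstOnes : ∀ {m} → ℕ → Fin m → Bool
firstOnes t i = toℕ i <ᵇ t

countTrue-firstOnes : ∀ {m} t → t ≤ m → countTrue {m} (firstOnes t) ≡ t
countTrue-firstOnes {zero}  zero    _         = refl
countTrue-firstOnes {suc m} zero    _         = countTrue-firstOnes {m} zero z≤n
countTrue-firstOnes {suc m} (suc t) (s≤s t≤m) = cong suc (countTrue-firstOnes {m} t t≤m)

sort-shifted : ∀ {k} t → t ≤ k →
               ∃ λ (w : List (Fin k)) → (false ∷ᶠ firstOnes t) ∘ permute w ≗ firstOnes t
sort-shifted zero _ = [] , λ { zero → refl ; (suc i) → refl }
sort-shifted {suc k} (suc t) (s≤s t≤k) with sort-shifted {k} t t≤k
... | w , sorted = map suc w ++ [ zero ] , sorted′
  where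
  step : ∀ j → (false ∷ᶠ firstOnes (suc t)) (transposeAdj zero (suc j)) ≡ (false ∷ᶠ firstOnes t) j
  step zero    = refl
  step (suc j) = refl
  sorted′ : (false ∷ᶠ firstOnes (suc t)) ∘ permute (map suc w ++ [ zero ]) ≗ firstOnes (suc t)
  sorted′ zero
    rewrite permute-++ (map suc w) [ zero ] zero | permute-map-suc-zero w = refl
  sorted′ (suc i)
    rewrite permute-++ (map suc w) [ zero ] (suc i) | permute-map-suc w i =
    trans (step (permute w i)) (sorted i)

sort : ∀ {k} (c : Fin (suc k) → Bool) →
       ∃ λ (w : List (Fin k)) → c ∘ permute w ≗ firstOnes (countTrue c)
sort {zero}  c = [] , λ { zero → singleton-sorted (c zero) }
  where
  singleton-sorted : ∀ b → b ≡ (0 <ᵇ boolToℕ b + 0)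
  singleton-sorted false = refl
  singleton-sorted true  = refl
sort {suc k} c with sort {k} (c ∘ suc) | c zero in c₀
... | w , sorted | true = map suc w , sorted′
  where
  sorted′ : c ∘ permute (map suc w) ≗ firstOnes (suc (countTrue (c ∘ suc)))
  sorted′ zero    rewrite permute-map-suc-zero w = c₀
  sorted′ (suc i) rewrite permute-map-suc w i    = sorted i
... | w , sorted | false with sort-shifted {suc k} (countTrue (c ∘ suc)) (countTrue≤ (c ∘ suc))
... | w′ , shifted = w′ ++ map suc w , sorted′
  where
  sorted-tail : c ∘ permute (map suc w) ≗ false ∷ᶠ firstOnes (countTrue (c ∘ suc))
  sorted-tail zero    rewrite permute-map-suc-zero w = c₀
  sorted-tail (suc i) rewrite permute-map-suc w i    = sorted i
  sorted′ : c ∘ permute (w′ ++ map suc w) ≗ firstOnes (countTrue (c ∘ suc))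
  sorted′ i rewrite permute-++ w′ (map suc w) i = trans (sorted-tail (permute w′ i)) (shifted i)

permute-transitive : ∀ {k} (c d : Fin (suc k) → Bool) → countTrue c ≡ countTrue d →
                     ∃ λ (w : List (Fin k)) → c ∘ permute w ≗ d
permute-transitive c d c≡d with sort c | sort d
... | w , c-sorted | w′ , d-sorted = reverse w′ ++ w , c∘perm≗d
  where
  c∘perm≗d : c ∘ permute (reverse w′ ++ w) ≗ d
  c∘perm≗d i rewrite permute-++ (reverse w′) w i = begin
    c (permute w j)               ≡⟨ c-sorted j ⟩
    firstOnes (countTrue c) j     ≡⟨ cong (λ t → firstOnes t j) c≡d ⟩
    firstOnes (countTrue d) j     ≡⟨ d-sorted j ⟨
    d (permute w′ j)              ≡⟨ cong d (permute-reverse w′ i) ⟩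
    d i                           ∎
    where
    open ≡-Reasoning
    j : Fin _
    j = permute (reverse w′) i

-- Vectors and matrices over F₂

·-congˡ : ∀ {n} {M N : Mat n} → (∀ a b → M a b ≡ N a b) → ∀ x → (M · x) ≈ (N · x)
·-congˡ M≡N x a = ⊕Σ-cong (λ b → cong (_∧ x b) (M≡N a b))

·-congʳ : ∀ {n} (M : Mat n) {x y : Vecℱ n} → x ≈ y → (M · x) ≈ (M · y)
·-congʳ M x≈y a = ⊕Σ-cong (λ b → cong (M a b ∧_) (x≈y b))

idM-· : ∀ {n} (x : Vecℱ n) → (idM · x) ≈ x
idM-· x a = ⊕Σ-select (≟-selectsˡ a) x

⊗-· : ∀ {n} (M N : Mat n) x → ((M ⊗ N) · x) ≈ (M · (N · x))
⊗-· M N x a = begin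
  ⊕Σ (λ c → ⊕Σ (λ b → M a b ∧ N b c) ∧ x c)
    ≡⟨ ⊕Σ-cong (λ c → ∧-distribʳ-⊕Σ (x c) (λ b → M a b ∧ N b c)) ⟩
  ⊕Σ (λ c → ⊕Σ (λ b → (M a b ∧ N b c) ∧ x c))
    ≡⟨ ⊕Σ-comm (λ c b → (M a b ∧ N b c) ∧ x c) ⟩
  ⊕Σ (λ b → ⊕Σ (λ c → (M a b ∧ N b c) ∧ x c))
    ≡⟨ ⊕Σ-cong (λ b → ⊕Σ-cong (λ c → ∧-assoc (M a b) (N b c) (x c))) ⟩
  ⊕Σ (λ b → ⊕Σ (λ c → M a b ∧ N b c ∧ x c))
    ≡⟨ ⊕Σ-cong (λ b → ∧-distribˡ-⊕Σ (M a b) (λ c → N b c ∧ x c)) ⟨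
  ⊕Σ (λ b → M a b ∧ (N · x) b) ∎
  where open ≡-Reasoning

⟨-,indicator⟩ : ∀ {n} (x : Vecℱ n) s → ⟨ x , (λ a → ⌊ a ≟ s ⌋) ⟩ ≡ x s
⟨-,indicator⟩ x s =
  trans (⊕Σ-cong (λ a → ∧-comm (x a) ⌊ a ≟ s ⌋)) (⊕Σ-select (≟-selects s) x)

inject₁-or-last : ∀ {k} (a : Fin (suc k)) → (∃ λ m → a ≡ inject₁ m) ⊎ a ≡ fromℕ k
inject₁-or-last {zero}  zero    = inj₂ refl
inject₁-or-last {suc k} zero    = inj₁ (zero , refl)
inject₁-or-last {suc k} (suc a) with inject₁-or-last a
... | inj₁ (m , a≡m) = inj₁ (suc m , cong suc a≡m)
... | inj₂ a≡last    = inj₂ (cong suc a≡last)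

constant-if-adjacent-equal : ∀ {k} (c : Fin (suc k) → Bool) →
                             (∀ m → c (inject₁ m) ≡ c (suc m)) → ∀ j → c j ≡ c zero
constant-if-adjacent-equal {zero}  c adj-eq zero    = refl
constant-if-adjacent-equal {suc k} c adj-eq zero    = refl
constant-if-adjacent-equal {suc k} c adj-eq (suc j) =
  trans (constant-if-adjacent-equal (c ∘ suc) (adj-eq ∘ suc) j) (sym (adj-eq zero))

prefixXor : ∀ {k} → (Fin k → Bool) → Bool → Fin (suc k) → Bool
prefixXor w b zero = b
prefixXor {suc k} w b (suc i) = prefixXor (w ∘ suc) (b xor w zero) i

prefixXor-step : ∀ {k} (w : Fin k → Bool) b m →
                 prefixXor w b (inject₁ m) xor prefixXor w b (suc m) ≡ w m
prefixXor-step w b zero = begin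
  b xor (b xor w zero) ≡⟨ xor-assoc b b (w zero) ⟨
  (b xor b) xor w zero ≡⟨ cong (_xor w zero) (xor-same b) ⟩
  w zero               ∎
  where open ≡-Reasoning
prefixXor-step w b (suc m) = prefixXor-step (w ∘ suc) (b xor w zero) m

prefixXor-not : ∀ {k} (w : Fin k → Bool) b j → prefixXor w (not b) j ≡ not (prefixXor w b j)
prefixXor-not w b zero = refl
prefixXor-not {suc k} w b (suc j)
  rewrite sym (not-distribˡ-xor b (w zero)) = prefixXor-not (w ∘ suc) (b xor w zero) j

-- The graph S

pathPart-inject₁ : ∀ {k} (m : Fin k) → pathPart (inject₁ m) ≡ just m
pathPart-inject₁ {suc k} zero    = refl
pathPart-inject₁ {suc k} (suc m) rewrite pathPart-inject₁ m = refl

module WPOrbits (k : ℕ) (T : Fin k → Bool) where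
  open Graph k T
  module ≈-Reasoning = SetoidReasoning (Fin n →-setoid Bool)

  adj-irrefl : ∀ a → adj a a ≡ false
  adj-irrefl a with pathPart a
  ... | just i  = adjacentℕ-irrefl (toℕ i)
  ... | nothing = refl

  adj-path : ∀ (m f : Fin k) → adj (inject₁ m) (inject₁ f) ≡ adjacentℕ (toℕ m) (toℕ f)
  adj-path m f rewrite pathPart-inject₁ m | pathPart-inject₁ f = refl

  flipAt : Fin n → Vecℱ n → Vecℱ n
  flipAt s x a = x a xor (x s ∧ adj a s)

  flipAt-cong : ∀ s {x y} → x ≈ y → flipAt s x ≈ flipAt s y
  flipAt-cong s x≈y a = cong₂ (λ u v → u xor (v ∧ adj a s)) (x≈y a) (x≈y s)

  flipAt-involutive : ∀ s x → flipAt s (flipAt s x) ≈ x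
  flipAt-involutive s x a rewrite adj-irrefl s with x a | x s | adj a s
  ... | false | false | _     = refl
  ... | false | true  | false = refl
  ... | false | true  | true  = refl
  ... | true  | false | _     = refl
  ... | true  | true  | false = refl
  ... | true  | true  | true  = refl

  flipAt-fixes : ∀ s x → x s ≡ false → flipAt s x ≈ x
  flipAt-fixes s x xₛ≡0 a rewrite xₛ≡0 = xor-identityʳ (x a)

  -- Both the flipping moves and the matrices flipℕ j used to build Π have this shape.
  move-entry : ∀ a b d x →
    (⌊ a ≟ b ⌋ ∨ (d ∧ adj a b)) ∧ x ≡ (⌊ a ≟ b ⌋ ∧ x) xor (d ∧ adj a b ∧ x)
  move-entry a b d x with a ≟ b
  ... | yes refl rewrite adj-irrefl a | ∧-zeroʳ d = sym (xor-identityʳ x)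
  ... | no  _    = ∧-assoc d (adj a b) x

  move-· : ∀ {D s} → Selects D s → ∀ x →
           ((λ a b → ⌊ a ≟ b ⌋ ∨ (D b ∧ adj a b)) · x) ≈ flipAt s x
  move-· {D} {s} D-sel x a = begin
    ⊕Σ (λ b → (⌊ a ≟ b ⌋ ∨ (D b ∧ adj a b)) ∧ x b)
      ≡⟨ ⊕Σ-cong (λ b → move-entry a b (D b) (x b)) ⟩
    ⊕Σ (λ b → (⌊ a ≟ b ⌋ ∧ x b) xor (D b ∧ adj a b ∧ x b))
      ≡⟨ ⊕Σ-distrib-xor (λ b → ⌊ a ≟ b ⌋ ∧ x b) (λ b → D b ∧ adj a b ∧ x b) ⟩
    ⊕Σ (λ b → ⌊ a ≟ b ⌋ ∧ x b) xor ⊕Σ (λ b → D b ∧ adj a b ∧ x b)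
      ≡⟨ cong₂ _xor_ (⊕Σ-select (≟-selectsˡ a) x) (⊕Σ-select D-sel (λ b → adj a b ∧ x b)) ⟩
    x a xor (adj a s ∧ x s)
      ≡⟨ cong (x a xor_) (∧-comm (adj a s) (x s)) ⟩
    flipAt s x a ∎
    where open ≡-Reasoning

  gen-· : ∀ m x → (gen m · x) ≈ flipAt (inject₁ m) x
  gen-· m = move-· (≟-selects (inject₁ m))

  flipℕ-· : ∀ j (m : Fin k) → toℕ m ≡ j → ∀ x → (flipℕ j · x) ≈ flipAt (inject₁ m) x
  flipℕ-· j m m≡j = move-· (≡ᵇ-selects (inject₁ m) (trans (toℕ-inject₁ m) m≡j))

  bar-path : ∀ j → j ≤ k → ∀ (m : Fin k) → bar j (inject₁ m) ≡ near (toℕ m) j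
  bar-path zero    _   zero    = refl
  bar-path zero    _   (suc m) = refl
  bar-path (suc j) j<k m = begin
    bar (suc j) (inject₁ m)
      ≡⟨ flipℕ-· j f f≡j (bar j) (inject₁ m) ⟩
    bar j (inject₁ m) xor (bar j (inject₁ f) ∧ adj (inject₁ m) (inject₁ f))
      ≡⟨ cong₂ (λ u v → u xor (v ∧ adj (inject₁ m) (inject₁ f)))
               (bar-path j j≤k m) (bar-path j j≤k f) ⟩
    near (toℕ m) j xor (near (toℕ f) j ∧ adj (inject₁ m) (inject₁ f))
      ≡⟨ cong (λ v → near (toℕ m) j xor (near (toℕ f) j ∧ v)) (adj-path m f) ⟩
    near (toℕ m) j xor (near (toℕ f) j ∧ adjacentℕ (toℕ m) (toℕ f))
      ≡⟨ cong (λ t → near (toℕ m) j xor (near t j ∧ adjacentℕ (toℕ m) t)) f≡j ⟩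
    near (toℕ m) j xor (near j j ∧ adjacentℕ (toℕ m) j)
      ≡⟨ cong (λ v → near (toℕ m) j xor (v ∧ adjacentℕ (toℕ m) j)) (near-diag j) ⟩
    near (toℕ m) j xor adjacentℕ (toℕ m) j
      ≡⟨ near-step (toℕ m) j ⟩
    near (toℕ m) (suc j) ∎
    where
    open ≡-Reasoning
    f : Fin k
    f = fromℕ< j<k
    f≡j : toℕ f ≡ j
    f≡j = toℕ-fromℕ< j<k
    j≤k : j ≤ k
    j≤k = ≤-trans (n≤1+n j) j<k

  Πv-path : ∀ i (m : Fin k) → Πv i (inject₁ m) ≡ near (toℕ m) (toℕ i)
  Πv-path i = bar-path (toℕ i) (toℕ≤pred[n] i)

  Πv-suc : ∀ (m : Fin k) → Πv (suc m) ≈ flipAt (inject₁ m) (Πv (inject₁ m))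
  Πv-suc m = begin
    Πv (suc m)                              ≈⟨ flipℕ-· (toℕ m) m refl (bar (toℕ m)) ⟩
    flipAt (inject₁ m) (bar (toℕ m))        ≈⟨ flipAt-cong (inject₁ m) bar-inject₁ ⟩
    flipAt (inject₁ m) (Πv (inject₁ m))     ∎
    where
    open ≈-Reasoning
    bar-inject₁ : bar (toℕ m) ≈ Πv (inject₁ m)
    bar-inject₁ a = cong (λ t → bar t a) (sym (toℕ-inject₁ m))

  gen-Πv : ∀ m i → (gen m · Πv i) ≈ Πv (transposeAdj m i)
  gen-Πv m i with transposeAdj-cases m i
  ... | inj₁ refl rewrite transposeAdj-inject₁ m = begin
    gen m · Πv (inject₁ m)               ≈⟨ gen-· m (Πv (inject₁ m)) ⟩
    flipAt (inject₁ m) (Πv (inject₁ m))  ≈⟨ Πv-suc m ⟨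
    Πv (suc m)                           ∎
    where open ≈-Reasoning
  ... | inj₂ (inj₁ refl) rewrite transposeAdj-suc m = begin
    gen m · Πv (suc m)                                       ≈⟨ gen-· m (Πv (suc m)) ⟩
    flipAt (inject₁ m) (Πv (suc m))                          ≈⟨ flipAt-cong (inject₁ m) (Πv-suc m) ⟩
    flipAt (inject₁ m) (flipAt (inject₁ m) (Πv (inject₁ m)))
      ≈⟨ flipAt-involutive (inject₁ m) (Πv (inject₁ m)) ⟩
    Πv (inject₁ m)                                           ∎
    where open ≈-Reasoning
  ... | inj₂ (inj₂ (fixed , far)) rewrite fixed = begin
    gen m · Πv i               ≈⟨ gen-· m (Πv i) ⟩
    flipAt (inject₁ m) (Πv i)  ≈⟨ flipAt-fixes (inject₁ m) (Πv i) (trans (Πv-path i m) far) ⟩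
    Πv i                       ∎
    where open ≈-Reasoning

  comb-cong : ∀ {c d} → c ≗ d → comb c ≈ comb d
  comb-cong c≗d a = ⊕Σ-cong (λ i → cong (_∧ Πv i a) (c≗d i))

  comb-zero : ∀ c → (∀ i → c i ≡ false) → comb c ≈ zeroV
  comb-zero c c≡0 a = ⊕Σ-zero (λ i → c i ∧ Πv i a) (λ i → cong (_∧ Πv i a) (c≡0 i))

  comb-distrib-xor : ∀ c d → comb (λ i → c i xor d i) ≈ (λ a → comb c a xor comb d a)
  comb-distrib-xor c d a =
    trans (⊕Σ-cong (λ i → ∧-distribʳ-xor (Πv i a) (c i) (d i)))
          (⊕Σ-distrib-xor (λ i → c i ∧ Πv i a) (λ i → d i ∧ Πv i a))

  ·-comb : ∀ (M : Mat n) c → (M · comb c) ≈ (λ a → ⊕Σ (λ i → c i ∧ (M · Πv i) a))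
  ·-comb M c a = begin
    ⊕Σ (λ b → M a b ∧ ⊕Σ (λ i → c i ∧ Πv i b))
      ≡⟨ ⊕Σ-cong (λ b → ∧-distribˡ-⊕Σ (M a b) (λ i → c i ∧ Πv i b)) ⟩
    ⊕Σ (λ b → ⊕Σ (λ i → M a b ∧ c i ∧ Πv i b))
      ≡⟨ ⊕Σ-comm (λ b i → M a b ∧ c i ∧ Πv i b) ⟩
    ⊕Σ (λ i → ⊕Σ (λ b → M a b ∧ c i ∧ Πv i b))
      ≡⟨ ⊕Σ-cong (λ i → ⊕Σ-cong (λ b → ∧Properties.x∙yz≈y∙xz (M a b) (c i) (Πv i b))) ⟩
    ⊕Σ (λ i → ⊕Σ (λ b → c i ∧ M a b ∧ Πv i b))
      ≡⟨ ⊕Σ-cong (λ i → ∧-distribˡ-⊕Σ (c i) (λ b → M a b ∧ Πv i b)) ⟨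
    ⊕Σ (λ i → c i ∧ (M · Πv i) a) ∎
    where open ≡-Reasoning

  gen-comb : ∀ m c → (gen m · comb c) ≈ comb (c ∘ transposeAdj m)
  gen-comb m c a = begin
    (gen m · comb c) a
      ≡⟨ ·-comb (gen m) c a ⟩
    ⊕Σ (λ i → c i ∧ (gen m · Πv i) a)
      ≡⟨ ⊕Σ-cong (λ i → cong₂ _∧_ (cong c (sym (transposeAdj-involutive m i)))
                                  (gen-Πv m i a)) ⟩
    ⊕Σ (λ i → c (transposeAdj m (transposeAdj m i)) ∧ Πv (transposeAdj m i) a)
      ≡⟨ ⊕Σ-transposeAdj m (λ i → c (transposeAdj m i) ∧ Πv i a) ⟩
    comb (c ∘ transposeAdj m) a ∎
    where open ≡-Reasoning

  wordM-comb : ∀ w c → (wordM w · comb c) ≈ comb (c ∘ permute w)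
  wordM-comb []      c = idM-· (comb c)
  wordM-comb (m ∷ w) c = begin
    (gen m ⊗ wordM w) · comb c        ≈⟨ ⊗-· (gen m) (wordM w) (comb c) ⟩
    gen m · (wordM w · comb c)        ≈⟨ ·-congʳ (gen m) (wordM-comb w c) ⟩
    gen m · comb (c ∘ permute w)      ≈⟨ gen-comb m (c ∘ permute w) ⟩
    comb (c ∘ permute (m ∷ w))        ∎
    where open ≈-Reasoning

  orbit⇔weight : ∀ {c u i} → countTrue c ≡ i → comb c ≈ u → ∀ v → InOrbit u v ⇔ InU i v
  orbit⇔weight {c} {u} refl c≈u v = mk⇔ to from
    where
    open ≈-Reasoning
    to : InOrbit u v → InU (countTrue c) v
    to (M , (w , M≡w) , Mu≈v) = c ∘ permute w , comb-permuted≈v , countTrue-permute w c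
      where
      comb-permuted≈v : comb (c ∘ permute w) ≈ v
      comb-permuted≈v = begin
        comb (c ∘ permute w)  ≈⟨ wordM-comb w c ⟨
        wordM w · comb c      ≈⟨ ·-congʳ (wordM w) c≈u ⟩
        wordM w · u           ≈⟨ ·-congˡ M≡w u ⟨
        M · u                 ≈⟨ Mu≈v ⟩
        v                     ∎
    from : InU (countTrue c) v → InOrbit u v
    from (d , d≈v , d≡c) with permute-transitive c d (sym d≡c)
    ... | w , c∘w≗d = wordM w , (w , λ _ _ → refl) , (begin
      wordM w · u               ≈⟨ ·-congʳ (wordM w) c≈u ⟨
      wordM w · comb c          ≈⟨ wordM-comb w c ⟩
      comb (c ∘ permute w)      ≈⟨ comb-cong c∘w≗d ⟩
      comb d                    ≈⟨ d≈v ⟩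
      v                         ∎)

  comb-path : ∀ c (m : Fin k) → comb c (inject₁ m) ≡ c (inject₁ m) xor c (suc m)
  comb-path c m = begin
    ⊕Σ (λ i → c i ∧ Πv i (inject₁ m))
      ≡⟨ ⊕Σ-cong (λ i → trans (cong (c i ∧_) (Πv-path i m)) (split i)) ⟩
    ⊕Σ (λ i → ((toℕ i ≡ᵇ toℕ m) ∧ c i) xor ((toℕ i ≡ᵇ suc (toℕ m)) ∧ c i))
      ≡⟨ ⊕Σ-distrib-xor (λ i → (toℕ i ≡ᵇ toℕ m) ∧ c i)
                        (λ i → (toℕ i ≡ᵇ suc (toℕ m)) ∧ c i) ⟩
    ⊕Σ (λ i → (toℕ i ≡ᵇ toℕ m) ∧ c i) xor ⊕Σ (λ i → (toℕ i ≡ᵇ suc (toℕ m)) ∧ c i)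
      ≡⟨ cong₂ _xor_ (⊕Σ-select (≡ᵇ-selects (inject₁ m) (toℕ-inject₁ m)) c)
                     (⊕Σ-select (≡ᵇ-selects (suc m) refl) c) ⟩
    c (inject₁ m) xor c (suc m) ∎
    where
    open ≡-Reasoning
    split : ∀ i → c i ∧ near (toℕ m) (toℕ i) ≡
                  ((toℕ i ≡ᵇ toℕ m) ∧ c i) xor ((toℕ i ≡ᵇ suc (toℕ m)) ∧ c i)
    split i = trans (∧-comm (c i) _)
                    (∧-distribʳ-xor (c i) (toℕ i ≡ᵇ toℕ m) (toℕ i ≡ᵇ suc (toℕ m)))

  module _ (odd : cardΠ₁ % 2 ≡ 1) where

    comb-all-last : comb (λ _ → true) lastV ≡ true
    comb-all-last = begin
      ⊕Σ (λ i → Πv i lastV)             ≡⟨ ⊕Σ-cong (λ i → ⟨-,indicator⟩ (Πv i) lastV) ⟨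
      ⊕Σ (λ i → ⟨ Πv i , char lastV ⟩)  ≡⟨ isOdd-countTrue (λ i → ⟨ Πv i , char lastV ⟩) ⟨
      isOdd cardΠ₁                      ≡⟨ %2≡1⇒isOdd cardΠ₁ odd ⟩
      true                              ∎
      where open ≡-Reasoning

    comb-kernel : ∀ c → comb c ≈ zeroV → ∀ j → c j ≡ false
    comb-kernel c c≈0 j = trans (c-constant j) (¬-not c₀≢1)
      where
      c-constant : ∀ j → c j ≡ c zero
      c-constant = constant-if-adjacent-equal c
        (λ m → xor≡false⇒≡ (trans (sym (comb-path c m)) (c≈0 (inject₁ m))))
      c₀≢1 : c zero ≢ true
      c₀≢1 c₀≡1 = contradiction (begin
        true                        ≡⟨ comb-all-last ⟨
        comb (λ _ → true) lastV     ≡⟨ comb-cong (λ i → sym (trans (c-constant i) c₀≡1)) lastV ⟩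
        comb c lastV                ≡⟨ c≈0 lastV ⟩
        false                       ∎) λ ()
        where open ≡-Reasoning

    comb-prefixXor-last : ∀ w b → comb (prefixXor w b) lastV ≡ b xor comb (prefixXor w false) lastV
    comb-prefixXor-last w false = refl
    comb-prefixXor-last w true  = begin
      comb (prefixXor w true) lastV
        ≡⟨ comb-cong (prefixXor-not w false) lastV ⟩
      comb (λ i → true xor prefixXor w false i) lastV
        ≡⟨ comb-distrib-xor (λ _ → true) (prefixXor w false) lastV ⟩
      comb (λ _ → true) lastV xor comb (prefixXor w false) lastV
        ≡⟨ cong (_xor comb (prefixXor w false) lastV) comb-all-last ⟩
      true xor comb (prefixXor w false) lastV ∎
      where open ≡-Reasoning

    comb-surjective : ∀ v → ∃ λ c → comb c ≈ v
    comb-surjective v = prefixXor w b , matches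
      where
      w : Fin k → Bool
      w = v ∘ inject₁
      b : Bool
      b = v lastV xor comb (prefixXor w false) lastV
      matches : comb (prefixXor w b) ≈ v
      matches a with inject₁-or-last a
      ... | inj₁ (m , refl) = trans (comb-path (prefixXor w b) m) (prefixXor-step w b m)
      ... | inj₂ refl       = begin
        comb (prefixXor w b) lastV                   ≡⟨ comb-prefixXor-last w b ⟩
        (v lastV xor X) xor X                        ≡⟨ xor-assoc (v lastV) X X ⟩
        v lastV xor (X xor X)                        ≡⟨ cong (v lastV xor_) (xor-same X) ⟩
        v lastV xor false                            ≡⟨ xor-identityʳ (v lastV) ⟩
        v lastV                                      ∎
        where
        open ≡-Reasoning
        X : Bool
        X = comb (prefixXor w false) lastV

lemma5p2 : (k : ℕ) → 1 ≤ k → (T : Fin k → Bool) → ∃ (λ j → T j ≡ true)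
    → Graph.cardΠ₁ k T % 2 ≡ 1
    → ((u : Fin (suc k) → Bool) → ¬ (u ≈ zeroV)
        → Σ ℕ λ i → (1 ≤ i) × (i ≤ suc k)
          × ((v : Fin (suc k) → Bool) → Graph.InOrbit k T u v ⇔ Graph.InU k T i v))
      × ((i : ℕ) → 1 ≤ i → i ≤ suc k
        → Σ (Fin (suc k) → Bool) λ u → ¬ (u ≈ zeroV)
          × ((v : Fin (suc k) → Bool) → Graph.InOrbit k T u v ⇔ Graph.InU k T i v))
lemma5p2 k _ T _ odd = orbit-of-nonzero , orbit-of-weight
  where
  open Graph k T
  open WPOrbits k T

  orbit-of-nonzero : (u : Vecℱ n) → ¬ (u ≈ zeroV) →
    Σ ℕ λ i → (1 ≤ i) × (i ≤ n) × (∀ v → InOrbit u v ⇔ InU i v)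
  orbit-of-nonzero u u≢0 with comb-surjective odd u
  ... | c , c≈u = countTrue c , 1≤countTrue c c≢0 , countTrue≤ c , orbit⇔weight {c} refl c≈u
    where
    c≢0 : ¬ (∀ i → c i ≡ false)
    c≢0 c≡0 = u≢0 (λ a → trans (sym (c≈u a)) (comb-zero c c≡0 a))

  orbit-of-weight : (i : ℕ) → 1 ≤ i → i ≤ n →
    Σ (Vecℱ n) λ u → ¬ (u ≈ zeroV) × (∀ v → InOrbit u v ⇔ InU i v)
  orbit-of-weight i 1≤i i≤n =
    comb (firstOnes i) ,
    (λ u≈0 → contradiction (comb-kernel odd (firstOnes i) u≈0 zero) (first≢0 1≤i)) ,
    orbit⇔weight {firstOnes i} (countTrue-firstOnes i i≤n) (λ _ → refl)
    where
    first≢0 : 1 ≤ i → firstOnes {n} i zero ≢ false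
    first≢0 (s≤s _) ()
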